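{- Let $n,\delta\in\mathbb{N}$ with $\delta\ge4$ and $n>\frac{32}{5}\delta^*+4$, where $\delta^*=\delta^2-2\lfloor\delta/2\rfloor+1$. If $X=(n_0,\ldots,n_r)$ is a finite sequence of nonnegative integers satisfying (D1) $n_0=1$; (D2) $\sum_{i=0}^\infty n_i=n$; (D3) $n_i\ge2$ for all $i\in\{1,\ldots,r-1\}$; (D4) for all $i\in\{0,\ldots,r\}$ with $i\equiv0\pmod5$, $n_{i-2}+n_{i-1}+n_i+n_{i+1}+n_{i+2}\ge\delta^*$; (D5) for all $i\in\{10,\ldots,r-9\}$ with $i\equiv0\pmod5$, $n_{i-2}+n_{i-1}+n_i+n_{i+1}+n_{i+2}\ge2\delta^*$, then $g(X)\le g(W_{n,\delta})$.
   Context: For a finite sequence $(n_0,\ldots,n_r)$, $n_i=0$ for integers $i<0$ or $i>r$, and $g((n_0,\ldots,n_r))=\sum_{i\ge0}i\,n_i$. Let $p=\lceil\frac{5n-32\delta^*-20}{10\delta^*}\rceil$ and $m=n-(2p+4)\delta^*$. Then $W_{n,\delta}$ is the sequence $(1,2,\delta^*-3,2,2,2,2,\delta^*-8,\,[2,2,2,2,2\delta^*-8]^p,\,[2,2,2,2,\delta^*-8]^2,\,m)$, where $[B]^k$ denotes $k$ consecutive repetitions of the block $B$. -}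

module Defs where

open import Data.Nat using (ℕ; zero; suc; _+_; _*_; _∸_; _/_; ⌊_/2⌋)
open import Data.Integer using (ℤ; +_; -[1+_]) renaming (_+_ to _+ℤ_; _-_ to _-ℤ_)
open import Data.List using (List; []; _∷_; length; zipWith; upTo; concat; replicate; _++_; [_])
open import Data.Nat.ListAction using (sum)

-- δ* = δ² − 2⌊δ/2⌋ + 1  (the subtraction never truncates since 2⌊δ/2⌋ ≤ δ ≤ δ²)
δ* : ℕ → ℕ
δ* δ = suc (δ * δ ∸ 2 * ⌊ δ /2⌋)

ceilDivSuc : ℕ → ℕ → ℕ
ceilDivSuc a k = (a + k) / suc k

at : List ℕ → ℕ → ℕ
at [] i = 0
at (x ∷ xs) zero = x
at (x ∷ xs) (suc i) = at xs i

-- n_i for integer indices i; n_i = 0 for i < 0 or i > r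
atℤ : List ℕ → ℤ → ℕ
atℤ X (+ i) = at X i
atℤ X -[1+ i ] = 0

window : List ℕ → ℕ → ℕ
window X i = atℤ X (+ i -ℤ + 2) + atℤ X (+ i -ℤ + 1) + atℤ X (+ i)
           + atℤ X (+ i +ℤ + 1) + atℤ X (+ i +ℤ + 2)

g : List ℕ → ℕ
g X = sum (zipWith _*_ (upTo (length X)) X)

-- p = ⌈(5n − 32δ* − 20)/(10δ*)⌉  (numerator positive under the hypothesis n > 32δ*/5 + 4)
pW : ℕ → ℕ → ℕ
pW n δ = ceilDivSuc (5 * n ∸ (32 * δ* δ + 20)) (10 * δ* δ ∸ 1)

-- m = n − (2p+4)δ*  (positive under the hypothesis)
mW : ℕ → ℕ → ℕ
mW n δ = n ∸ (2 * pW n δ + 4) * δ* δ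

rep : ℕ → List ℕ → List ℕ
rep k B = concat (replicate k B)

W : ℕ → ℕ → List ℕ
W n δ = let d = δ* δ in
  (1 ∷ 2 ∷ (d ∸ 3) ∷ 2 ∷ 2 ∷ 2 ∷ 2 ∷ (d ∸ 8) ∷ [])
  ++ rep (pW n δ) (2 ∷ 2 ∷ 2 ∷ 2 ∷ (2 * d ∸ 8) ∷ [])
  ++ rep 2 (2 ∷ 2 ∷ 2 ∷ 2 ∷ (d ∸ 8) ∷ [])
  ++ [ mW n δ ]

-- Since Σ i·nᵢ + Σ (r − i)·nᵢ = r·n, maximising g(X) for a given length amounts to minimising
-- the comoment Σ (r − i)·nᵢ. If X has length 5c + A + 9 with A < 5, the windows at 0 and 5 and
-- the c full windows after them each carry mass δ* (2δ* where (D5) applies) and every inner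
-- entry is at least 2; weighting these masses by their distance to the end bounds the comoment
-- from below. The resulting bound on g(X) lies below the interpolation, between c and c + 1, of
-- the concave function x ↦ (5x + 8)n − cost x, whose maximum over ℕ is at x = p + 2 by the
-- choice of p; and W is built so that its comoment is exactly cost (p + 2), so g(W) is that
-- maximum. Sequences of length at most 8 have g ≤ 7n, which is already below g(W).

module Submission where

open import Defs
open import Data.Nat using (ℕ; _+_; _*_; _≤_; _<_)
open import Data.Nat.Divisibility using (_∣_)
open import Data.List using (List; length)
open import Data.Nat.ListAction using (sum)
open import Relation.Binary.PropositionalEquality using (_≡_)

open import Data.Nat using (zero; suc; _∸_; _/_; _%_; z≤n; s≤s; ⌊_/2⌋; ⌈_/2⌉; _≤?_)
open import Data.Nat.Properties
open import Data.Sum using (inj₁; inj₂)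
open import Data.Product using (_,_)
open import Data.Nat.DivMod using (m≡m%n+[m/n]*n; m%n<n; m/n*n≤m)
open import Data.Nat.Divisibility using (divides)
open import Data.Nat.ListAction.Properties using (sum-++)
open import Data.Nat.Tactic.RingSolver using (solve-∀)
open import Data.List using ([]; _∷_; _++_; [_]; zipWith; applyUpTo)
open import Data.List.Properties using (length-++)
open import Data.List.Relation.Binary.Pointwise using (Pointwise; []; _∷_; Pointwise-length)
open import Relation.Binary.PropositionalEquality using (refl; sym; trans; cong; cong₂; subst; subst₂; module ≡-Reasoning)
open import Relation.Nullary using (yes; no)
open import Algebra.Properties.CommutativeSemigroup +-commutativeSemigroup using (x∙yz≈xz∙y; xy∙z≈xz∙y)

-- Moments

moment : List ℕ → ℕ
moment []       = 0
moment (x ∷ xs) = sum xs + moment xs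

comoment : List ℕ → ℕ
comoment []       = 0
comoment (x ∷ xs) = length xs * x + comoment xs

shifted-moment : ∀ (X : List ℕ) c (f : ℕ → ℕ) → (∀ i → f i ≡ c + i)
               → sum (zipWith _*_ (applyUpTo f (length X)) X) ≡ c * sum X + moment X
shifted-moment []       c f f≗ = sym (cong (_+ 0) (*-zeroʳ c))
shifted-moment (x ∷ xs) c f f≗ = begin
    f 0 * x + sum (zipWith _*_ (applyUpTo (λ i → f (suc i)) (length xs)) xs)
  ≡⟨ cong₂ _+_ (cong (_* x) (f≗ 0)) (shifted-moment xs (suc c) _ λ i → trans (f≗ (suc i)) (+-suc c i)) ⟩
    (c + 0) * x + (suc c * sum xs + moment xs)
  ≡⟨ regroup c x (sum xs) (moment xs) ⟩
    c * (x + sum xs) + (sum xs + moment xs)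
  ∎
  where
  open ≡-Reasoning
  regroup : ∀ c x s m → (c + 0) * x + ((1 + c) * s + m) ≡ c * (x + s) + (s + m)
  regroup = solve-∀

g≡moment : ∀ X → g X ≡ moment X
g≡moment X = shifted-moment X 0 (λ i → i) (λ i → refl)

moment+comoment : ∀ x xs → moment (x ∷ xs) + comoment (x ∷ xs) ≡ length xs * sum (x ∷ xs)
moment+comoment x []       = refl
moment+comoment x (y ∷ ys) = begin
    (s + moment (y ∷ ys)) + (suc ℓ * x + comoment (y ∷ ys))
  ≡⟨ regroup s (moment (y ∷ ys)) (comoment (y ∷ ys)) ℓ x ⟩
    s + suc ℓ * x + (moment (y ∷ ys) + comoment (y ∷ ys))
  ≡⟨ cong (s + suc ℓ * x +_) (moment+comoment y ys) ⟩
    s + suc ℓ * x + ℓ * s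
  ≡⟨ collect s ℓ x ⟩
    suc ℓ * (x + s)
  ∎
  where
  open ≡-Reasoning
  s ℓ : ℕ
  s = sum (y ∷ ys)
  ℓ = length ys
  regroup : ∀ s m c ℓ x → (s + m) + ((1 + ℓ) * x + c) ≡ s + (1 + ℓ) * x + (m + c)
  regroup = solve-∀
  collect : ∀ s ℓ x → s + (1 + ℓ) * x + ℓ * s ≡ (1 + ℓ) * (x + s)
  collect = solve-∀

g+comoment : ∀ x xs → g (x ∷ xs) + comoment (x ∷ xs) ≡ length xs * sum (x ∷ xs)
g+comoment x xs = trans (cong (_+ comoment (x ∷ xs)) (g≡moment (x ∷ xs))) (moment+comoment x xs)

comoment-++ : ∀ A B → comoment (A ++ B) ≡ comoment A + length B * sum A + comoment B
comoment-++ []      B = cong (_+ comoment B) (sym (*-zeroʳ (length B)))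
comoment-++ (x ∷ A) B = begin
    length (A ++ B) * x + comoment (A ++ B)
  ≡⟨ cong₂ (λ ℓ c → ℓ * x + c) (length-++ A) (comoment-++ A B) ⟩
    (length A + length B) * x + (comoment A + length B * sum A + comoment B)
  ≡⟨ regroup (length A) (length B) x (comoment A) (sum A) (comoment B) ⟩
    length A * x + comoment A + length B * (x + sum A) + comoment B
  ∎
  where
  open ≡-Reasoning
  regroup : ∀ ℓA ℓB x cA sA cB
          → (ℓA + ℓB) * x + (cA + ℓB * sA + cB) ≡ ℓA * x + cA + ℓB * (x + sA) + cB
  regroup = solve-∀

length-rep : ∀ p (B : List ℕ) → length (rep p B) ≡ p * length B
length-rep zero    B = refl
length-rep (suc p) B = trans (length-++ B) (cong (length B +_) (length-rep p B))

sum-rep : ∀ p B → sum (rep p B) ≡ p * sum B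
sum-rep zero    B = refl
sum-rep (suc p) B = trans (sum-++ B (rep p B)) (cong (sum B +_) (sum-rep p B))

-- Doubled to avoid the triangular number p(p − 1)/2.
comoment-rep : ∀ p B → 2 * comoment (rep p B) + p * (length B * sum B)
                     ≡ p * (2 * comoment B + p * (length B * sum B))
comoment-rep zero    B = refl
comoment-rep (suc p) B = begin
    2 * comoment (B ++ rep p B) + suc p * (ℓ * s)
  ≡⟨ cong (λ c → 2 * c + suc p * (ℓ * s)) (comoment-++ B (rep p B)) ⟩
    2 * (comoment B + length (rep p B) * s + C) + suc p * (ℓ * s)
  ≡⟨ cong (λ ℓR → 2 * (comoment B + ℓR * s + C) + suc p * (ℓ * s)) (length-rep p B) ⟩
    2 * (comoment B + p * ℓ * s + C) + suc p * (ℓ * s)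
  ≡⟨ regroup (comoment B) p ℓ s C ⟩
    (2 * C + p * (ℓ * s)) + (2 * comoment B + (2 * p + 1) * (ℓ * s))
  ≡⟨ cong (_+ (2 * comoment B + (2 * p + 1) * (ℓ * s))) (comoment-rep p B) ⟩
    p * (2 * comoment B + p * (ℓ * s)) + (2 * comoment B + (2 * p + 1) * (ℓ * s))
  ≡⟨ collect (comoment B) p (ℓ * s) ⟩
    suc p * (2 * comoment B + suc p * (ℓ * s))
  ∎
  where
  open ≡-Reasoning
  ℓ s C : ℕ
  ℓ = length B
  s = sum B
  C = comoment (rep p B)
  regroup : ∀ cB p ℓ s C → 2 * (cB + p * ℓ * s + C) + (1 + p) * (ℓ * s)
          ≡ (2 * C + p * (ℓ * s)) + (2 * cB + (2 * p + 1) * (ℓ * s))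
  regroup = solve-∀
  collect : ∀ cB p t → p * (2 * cB + p * t) + (2 * cB + (2 * p + 1) * t)
          ≡ (1 + p) * (2 * cB + (1 + p) * t)
  collect = solve-∀

comoment-≥ : ∀ x xs → (∀ i → suc i < length (x ∷ xs) → 2 ≤ at (x ∷ xs) i)
           → length xs * suc (length xs) ≤ comoment (x ∷ xs)
comoment-≥ x []       _   = z≤n
comoment-≥ x (y ∷ ys) ≥2 = begin
    suc ℓ * suc (suc ℓ)
  ≡⟨ split ℓ ⟩
    suc ℓ * 2 + ℓ * suc ℓ
  ≤⟨ +-mono-≤ (*-monoʳ-≤ (suc ℓ) (≥2 0 (s≤s (s≤s z≤n)))) (comoment-≥ y ys λ i i<ℓ → ≥2 (suc i) (s≤s i<ℓ)) ⟩
    suc ℓ * x + comoment (y ∷ ys)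
  ∎
  where
  open ≤-Reasoning
  ℓ : ℕ
  ℓ = length ys
  split : ∀ ℓ → (1 + ℓ) * (2 + ℓ) ≡ (1 + ℓ) * 2 + ℓ * (1 + ℓ)
  split = solve-∀

comoment-mono : ∀ {xs ys} → Pointwise _≤_ xs ys → comoment xs ≤ comoment ys
comoment-mono []              = z≤n
comoment-mono (x≤y ∷ xs≤ys) =
  +-mono-≤ (*-mono-≤ (≤-reflexive (Pointwise-length xs≤ys)) x≤y) (comoment-mono xs≤ys)

-- Arithmetic of δ* and p

2⌊n/2⌋≤n : ∀ n → 2 * ⌊ n /2⌋ ≤ n
2⌊n/2⌋≤n n = begin
    2 * ⌊ n /2⌋          ≡⟨ cong (⌊ n /2⌋ +_) (+-identityʳ ⌊ n /2⌋) ⟩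
    ⌊ n /2⌋ + ⌊ n /2⌋    ≤⟨ +-monoʳ-≤ ⌊ n /2⌋ (⌊n/2⌋≤⌈n/2⌉ n) ⟩
    ⌊ n /2⌋ + ⌈ n /2⌉    ≡⟨ ⌊n/2⌋+⌈n/2⌉≡n n ⟩
    n                    ∎
  where open ≤-Reasoning

8≤δ* : ∀ {δ} → 4 ≤ δ → 8 ≤ δ* δ
8≤δ* {δ} 4≤δ = s≤s (≤-trans (m+n≤o⇒m≤o∸n 7 7+δ≤δ²) (∸-monoʳ-≤ (δ * δ) (2⌊n/2⌋≤n δ)))
  where
  open ≤-Reasoning
  7+δ≤δ² : 7 + δ ≤ δ * δ
  7+δ≤δ² = begin
      7 + δ      ≤⟨ +-monoˡ-≤ δ (≤-trans (≤ᵇ⇒≤ 7 12 _) (*-monoʳ-≤ 3 4≤δ)) ⟩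
      3 * δ + δ  ≡⟨ +-comm (3 * δ) δ ⟩
      4 * δ      ≤⟨ *-monoˡ-≤ δ 4≤δ ⟩
      δ * δ      ∎

ceilDivSuc-upper : ∀ a k → ceilDivSuc a k * suc k ≤ a + k
ceilDivSuc-upper a k = m/n*n≤m (a + k) (suc k)

ceilDivSuc-lower : ∀ a k → a ≤ ceilDivSuc a k * suc k
ceilDivSuc-lower a k = +-cancelʳ-≤ k a (q * suc k) (begin
    a + k                      ≡⟨ m≡m%n+[m/n]*n (a + k) (suc k) ⟩
    (a + k) % suc k + q * suc k ≤⟨ +-monoˡ-≤ (q * suc k) (≤-pred (m%n<n (a + k) (suc k))) ⟩
    k + q * suc k              ≡⟨ +-comm k (q * suc k) ⟩
    q * suc k + k              ∎)
  where
  open ≤-Reasoning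
  q : ℕ
  q = ceilDivSuc a k

-- The concave objective

-- For a sequence of length 5x + 9 and sum n, g = revenue n x − comoment, and cost d x bounds
-- the comoment of such an admissible sequence from below (with equality for W, x = p + 2).
revenue : ℕ → ℕ → ℕ
revenue n x = (5 * x + 8) * n

cost : ℕ → ℕ → ℕ
cost d x = d * (5 * (x * x) + 7 * x) + 20 * x + 24

marginal-cost : ℕ → ℕ → ℕ → ℕ
marginal-cost d x s = d * (10 * x + 5 * s + 7) + 20

revenue-+ : ∀ n x s → revenue n (x + s) ≡ revenue n x + s * (5 * n)
revenue-+ = expand
  where
  expand : ∀ n x s → (5 * (x + s) + 8) * n ≡ (5 * x + 8) * n + s * (5 * n)
  expand = solve-∀

cost-+ : ∀ d x s → cost d (x + s) ≡ cost d x + s * marginal-cost d x s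
cost-+ = expand
  where
  expand : ∀ d x s → d * (5 * ((x + s) * (x + s)) + 7 * (x + s)) + 20 * (x + s) + 24
         ≡ d * (5 * (x * x) + 7 * x) + 20 * x + 24 + s * (d * (10 * x + 5 * s + 7) + 20)
  expand = solve-∀

revenue-cost-rising : ∀ {n d} x s → 10 * d * (x + s) + 2 * d + 20 < 5 * n
                    → revenue n x + cost d (x + s) ≤ revenue n (x + s) + cost d x
revenue-cost-rising {n} {d} x zero _ =
  subst (λ y → revenue n x + cost d y ≤ revenue n y + cost d x) (sym (+-identityʳ x)) ≤-refl
revenue-cost-rising {n} {d} x (suc s) below = begin
    revenue n x + cost d (x + suc s)
  ≡⟨ cong (revenue n x +_) (cost-+ d x (suc s)) ⟩
    revenue n x + (cost d x + suc s * marginal-cost d x (suc s))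
  ≤⟨ +-monoʳ-≤ (revenue n x) (+-monoʳ-≤ (cost d x) (*-monoʳ-≤ (suc s) (<⇒≤ (≤-<-trans marginal≤ below)))) ⟩
    revenue n x + (cost d x + suc s * (5 * n))
  ≡⟨ x∙yz≈xz∙y (revenue n x) (cost d x) (suc s * (5 * n)) ⟩
    revenue n x + suc s * (5 * n) + cost d x
  ≡⟨ cong (_+ cost d x) (revenue-+ n x (suc s)) ⟨
    revenue n (x + suc s) + cost d x
  ∎
  where
  open ≤-Reasoning
  marginal≤ : marginal-cost d x (suc s) ≤ 10 * d * (x + suc s) + 2 * d + 20
  marginal≤ = subst (marginal-cost d x (suc s) ≤_) (slack d x s) (m≤m+n _ (5 * d * s))
    where
    slack : ∀ d x s → d * (10 * x + 5 * (1 + s) + 7) + 20 + 5 * d * s ≡ 10 * d * (x + (1 + s)) + 2 * d + 20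
    slack = solve-∀

revenue-cost-falling : ∀ {n d} P s → 5 * n ≤ 10 * d * P + 12 * d + 20
                     → revenue n (P + s) + cost d P ≤ revenue n P + cost d (P + s)
revenue-cost-falling {n} {d} P zero _ =
  subst (λ y → revenue n y + cost d P ≤ revenue n P + cost d y) (sym (+-identityʳ P)) ≤-refl
revenue-cost-falling {n} {d} P (suc s) above = begin
    revenue n (P + suc s) + cost d P
  ≡⟨ cong (_+ cost d P) (revenue-+ n P (suc s)) ⟩
    revenue n P + suc s * (5 * n) + cost d P
  ≤⟨ +-monoˡ-≤ (cost d P) (+-monoʳ-≤ (revenue n P) (*-monoʳ-≤ (suc s) (≤-trans above marginal≥))) ⟩
    revenue n P + suc s * marginal-cost d P (suc s) + cost d P
  ≡⟨ xy∙z≈xz∙y (revenue n P) _ (cost d P) ⟩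
    revenue n P + cost d P + suc s * marginal-cost d P (suc s)
  ≡⟨ +-assoc (revenue n P) (cost d P) _ ⟩
    revenue n P + (cost d P + suc s * marginal-cost d P (suc s))
  ≡⟨ cong (revenue n P +_) (cost-+ d P (suc s)) ⟨
    revenue n P + cost d (P + suc s)
  ∎
  where
  open ≤-Reasoning
  marginal≥ : 10 * d * P + 12 * d + 20 ≤ marginal-cost d P (suc s)
  marginal≥ = subst (10 * d * P + 12 * d + 20 ≤_) (slack d P s) (m≤m+n _ (5 * d * s))
    where
    slack : ∀ d P s → 10 * d * P + 12 * d + 20 + 5 * d * s ≡ d * (10 * P + 5 * (1 + s) + 7) + 20
    slack = solve-∀

-- The hypotheses say that P maximises the concave function revenue n − cost d over ℕ:
-- the marginal cost of the step P − 1 → P is below 5n, that of P → P + 1 is above it.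
revenue-cost-optimal : ∀ {n d P} → 10 * d * P + 2 * d + 20 < 5 * n → 5 * n ≤ 10 * d * P + 12 * d + 20
                     → ∀ x → revenue n x + cost d P ≤ revenue n P + cost d x
revenue-cost-optimal {n} {d} {P} below above x with ≤-total x P
... | inj₁ x≤P with m≤n⇒∃[o]m+o≡n x≤P
...   | s , refl = revenue-cost-rising {n} {d} x s below
revenue-cost-optimal {n} {d} {P} below above x | inj₂ P≤x with m≤n⇒∃[o]m+o≡n P≤x
...   | s , refl = revenue-cost-falling {n} {d} P s above

-- Lower bound on the comoment of admissible sequences

record Admissible (d : ℕ) (X : List ℕ) : Set where
  field
    head≡1    : at X 0 ≡ 1
    entry≥2   : ∀ i → 1 ≤ i → i + 2 ≤ length X → 2 ≤ at X i
    window≥d  : ∀ i → i < length X → 5 ∣ i → d ≤ window X i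
    window≥2d : ∀ i → 10 ≤ i → i + 10 ≤ length X → 5 ∣ i → 2 * d ≤ window X i

-- blockFactor u a * d is the guaranteed sum of a window of five entries followed by
-- 5u + a + 1 further entries: only far enough from the end does (D5) apply.
blockFactor : ℕ → ℕ → ℕ
blockFactor (suc (suc u)) a       = 2
blockFactor (suc zero)    (suc a) = 2
blockFactor _             _       = 1

blockWeight : ℕ → ℕ → ℕ
blockWeight zero    a = 0
blockWeight (suc c) a = (c * 5 + suc a) * blockFactor c a + blockWeight c a

module _ {d : ℕ} {X : List ℕ} (adm : Admissible d X) (k r : ℕ) (len : length X ≡ (10 + k * 5) + (4 + r)) where
  open Admissible adm

  block-window≥d : d ≤ window X (10 + k * 5)
  block-window≥d = window≥d _ (subst (_ <_) (sym len) (m<m+n _ (s≤s z≤n))) (divides (2 + k) refl)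

  block-window≥2d : 6 ≤ r → 2 * d ≤ window X (10 + k * 5)
  block-window≥2d 6≤r =
    window≥2d _ (m≤m+n 10 _) (subst (_ ≤_) (sym len) (+-monoʳ-≤ (10 + k * 5) (+-monoʳ-≤ 4 6≤r))) (divides (2 + k) refl)

blockFactor-sound : ∀ {d X} → Admissible d X → ∀ k u a → length X ≡ (10 + k * 5) + (4 + (u * 5 + a))
                  → blockFactor u a * d ≤ window X (10 + k * 5)
blockFactor-sound adm k (suc (suc u)) a len = block-window≥2d adm k _ len (m≤m+n 6 _)
blockFactor-sound adm k (suc zero) (suc a) len = block-window≥2d adm k _ len (m≤m+n 6 a)
blockFactor-sound {d} adm k zero a len =
  ≤-trans (≤-reflexive (*-identityˡ d)) (block-window≥d adm k _ len)
blockFactor-sound {d} adm k (suc zero) zero len =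
  ≤-trans (≤-reflexive (*-identityˡ d)) (block-window≥d adm k _ len)

window₃≡sum : ∀ y₀ y₁ y₂ → y₀ + y₁ + y₂ ≡ sum (y₀ ∷ y₁ ∷ y₂ ∷ [])
window₃≡sum = reassociate
  where
  reassociate : ∀ y₀ y₁ y₂ → y₀ + y₁ + y₂ ≡ y₀ + (y₁ + (y₂ + 0))
  reassociate = solve-∀

window₅≡sum : ∀ y₀ y₁ y₂ y₃ y₄ → y₀ + y₁ + y₂ + y₃ + y₄ ≡ sum (y₀ ∷ y₁ ∷ y₂ ∷ y₃ ∷ y₄ ∷ [])
window₅≡sum = reassociate
  where
  reassociate : ∀ y₀ y₁ y₂ y₃ y₄ → y₀ + y₁ + y₂ + y₃ + y₄ ≡ y₀ + (y₁ + (y₂ + (y₃ + (y₄ + 0))))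
  reassociate = solve-∀

comoment-blocks-≥ : ∀ {d} a c (Y : List ℕ) → length Y ≡ c * 5 + suc a
                  → (∀ i → suc i < length Y → 2 ≤ at Y i)
                  → (∀ k → k < c → blockFactor (c ∸ suc k) a * d ≤ window Y (2 + k * 5))
                  → d * blockWeight c a + 20 * c + a * suc a ≤ comoment Y
comoment-blocks-≥ {d} a zero (y ∷ ys) len ≥2 _ rewrite *-zeroʳ d =
  subst (λ ℓ → ℓ * suc ℓ ≤ comoment (y ∷ ys)) (suc-injective len) (comoment-≥ y ys ≥2)
comoment-blocks-≥ {d} a (suc c) (y₀ ∷ y₁ ∷ y₂ ∷ y₃ ∷ y₄ ∷ Z) len ≥2 blocks = begin
    d * ((c * 5 + suc a) * blockFactor c a + blockWeight c a) + 20 * suc c + a * suc a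
  ≡⟨ regroup d (c * 5 + suc a) (blockFactor c a) (blockWeight c a) c (a * suc a) ⟩
    20 + (c * 5 + suc a) * (blockFactor c a * d) + (d * blockWeight c a + 20 * c + a * suc a)
  ≤⟨ +-mono-≤ (+-mono-≤ block-comoment (*-mono-≤ (≤-reflexive (sym lenZ)) block-sum)) rest ⟩
    comoment B + length Z * sum B + comoment Z
  ≡⟨ comoment-++ B Z ⟨
    comoment (B ++ Z)
  ∎
  where
  open ≤-Reasoning
  B : List ℕ
  B = y₀ ∷ y₁ ∷ y₂ ∷ y₃ ∷ y₄ ∷ []
  lenZ : length Z ≡ c * 5 + suc a
  lenZ = +-cancelˡ-≡ 5 _ _ len
  entry : ∀ i → 2 + i ≤ 5 → 2 ≤ at (B ++ Z) i
  entry i le = ≥2 i (≤-trans le (m≤m+n 5 (length Z)))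
  block-comoment : 20 ≤ comoment B
  block-comoment = comoment-mono (entry 0 (≤ᵇ⇒≤ 2 5 _) ∷ entry 1 (≤ᵇ⇒≤ 3 5 _) ∷ entry 2 (≤ᵇ⇒≤ 4 5 _)
                                  ∷ entry 3 ≤-refl ∷ ≤-refl {y₄} ∷ [])
  block-sum : blockFactor c a * d ≤ sum B
  block-sum = subst (blockFactor c a * d ≤_) (window₅≡sum y₀ y₁ y₂ y₃ y₄) (blocks 0 (s≤s z≤n))
  rest : d * blockWeight c a + 20 * c + a * suc a ≤ comoment Z
  rest = comoment-blocks-≥ a c Z lenZ (λ i i<ℓ → ≥2 (5 + i) (+-monoʳ-≤ 5 i<ℓ)) (λ k k<c → blocks (suc k) (s≤s k<c))
  regroup : ∀ d M f w c t → d * (M * f + w) + 20 * (1 + c) + t ≡ 20 + M * (f * d) + (d * w + 20 * c + t)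
  regroup = solve-∀

comoment-head-≥ : ∀ {d} x₀ x₁ x₂ x₃ x₄ x₅ x₆ x₇ Y → 1 ≤ length Y
                → Admissible d (x₀ ∷ x₁ ∷ x₂ ∷ x₃ ∷ x₄ ∷ x₅ ∷ x₆ ∷ x₇ ∷ Y)
                → (2 * length Y + 5) * d + 24 + comoment Y ≤ comoment (x₀ ∷ x₁ ∷ x₂ ∷ x₃ ∷ x₄ ∷ x₅ ∷ x₆ ∷ x₇ ∷ Y)
comoment-head-≥ {d} x₀ x₁ x₂ x₃ x₄ x₅ x₆ x₇ Y 1≤L adm = begin
    (2 * L + 5) * d + 24 + comoment Y
  ≡⟨ regroup L d (comoment Y) ⟩
    4 + (5 + L) * d + (20 + L * d + comoment Y)
  ≤⟨ +-mono-≤ (+-mono-≤ head-comoment (*-monoʳ-≤ (5 + L) head-sum))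
              (+-monoˡ-≤ (comoment Y) (+-mono-≤ block-comoment (*-monoʳ-≤ L block-sum))) ⟩
    comoment A + (5 + L) * sum A + (comoment B + L * sum B + comoment Y)
  ≡⟨ cong (comoment A + (5 + L) * sum A +_) (comoment-++ B Y) ⟨
    comoment A + (5 + L) * sum A + comoment (B ++ Y)
  ≡⟨ comoment-++ A (B ++ Y) ⟨
    comoment (A ++ B ++ Y)
  ∎
  where
  open ≤-Reasoning
  open Admissible adm
  A B : List ℕ
  A = x₀ ∷ x₁ ∷ x₂ ∷ []
  B = x₃ ∷ x₄ ∷ x₅ ∷ x₆ ∷ x₇ ∷ []
  L : ℕ
  L = length Y
  entry : ∀ i → 1 ≤ i → i + 2 ≤ 9 → 2 ≤ at (A ++ B ++ Y) i
  entry i 1≤i le = entry≥2 i 1≤i (≤-trans le (+-monoʳ-≤ 8 1≤L))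
  head-comoment : 4 ≤ comoment A
  head-comoment = comoment-mono (≤-reflexive (sym head≡1) ∷ entry 1 ≤-refl (≤ᵇ⇒≤ 3 9 _) ∷ ≤-refl {x₂} ∷ [])
  head-sum : d ≤ sum A
  head-sum = subst (d ≤_) (window₃≡sum x₀ x₁ x₂) (window≥d 0 (s≤s z≤n) (divides 0 refl))
  block-comoment : 20 ≤ comoment B
  block-comoment = comoment-mono (entry 3 (≤ᵇ⇒≤ 1 3 _) (≤ᵇ⇒≤ 5 9 _) ∷ entry 4 (≤ᵇ⇒≤ 1 4 _) (≤ᵇ⇒≤ 6 9 _)
                                  ∷ entry 5 (≤ᵇ⇒≤ 1 5 _) (≤ᵇ⇒≤ 7 9 _) ∷ entry 6 (≤ᵇ⇒≤ 1 6 _) (≤ᵇ⇒≤ 8 9 _)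
                                  ∷ ≤-refl {x₇} ∷ [])
  block-sum : d ≤ sum B
  block-sum = subst (d ≤_) (window₅≡sum x₃ x₄ x₅ x₆ x₇) (window≥d 5 (m≤m+n 6 _) (divides 1 refl))
  regroup : ∀ L d t → (2 * L + 5) * d + 24 + t ≡ 4 + (5 + L) * d + (20 + L * d + t)
  regroup = solve-∀

comomentBound : ℕ → ℕ → ℕ → ℕ
comomentBound d c a = (2 * (c * 5 + suc a) + 5) * d + 24 + (d * blockWeight c a + 20 * c + a * suc a)

comomentBound≤comoment : ∀ {d} c a x₀ x₁ x₂ x₃ x₄ x₅ x₆ x₇ Y → length Y ≡ c * 5 + suc a
                       → Admissible d (x₀ ∷ x₁ ∷ x₂ ∷ x₃ ∷ x₄ ∷ x₅ ∷ x₆ ∷ x₇ ∷ Y)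
                       → comomentBound d c a ≤ comoment (x₀ ∷ x₁ ∷ x₂ ∷ x₃ ∷ x₄ ∷ x₅ ∷ x₆ ∷ x₇ ∷ Y)
comomentBound≤comoment {d} c a x₀ x₁ x₂ x₃ x₄ x₅ x₆ x₇ Y len adm = begin
    (2 * (c * 5 + suc a) + 5) * d + 24 + R
  ≡⟨ cong (λ ℓ → (2 * ℓ + 5) * d + 24 + R) len ⟨
    (2 * length Y + 5) * d + 24 + R
  ≤⟨ +-monoʳ-≤ ((2 * length Y + 5) * d + 24) (comoment-blocks-≥ a c Y len entries blocks) ⟩
    (2 * length Y + 5) * d + 24 + comoment Y
  ≤⟨ comoment-head-≥ x₀ x₁ x₂ x₃ x₄ x₅ x₆ x₇ Y (subst (1 ≤_) (sym len) (m≤n⇒m≤o+n (c * 5) (s≤s z≤n))) adm ⟩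
    comoment (x₀ ∷ x₁ ∷ x₂ ∷ x₃ ∷ x₄ ∷ x₅ ∷ x₆ ∷ x₇ ∷ Y)
  ∎
  where
  open ≤-Reasoning
  open Admissible adm
  R : ℕ
  R = d * blockWeight c a + 20 * c + a * suc a
  entries : ∀ i → suc i < length Y → 2 ≤ at Y i
  entries i i<L = entry≥2 (8 + i) (s≤s z≤n) (subst (_≤ 8 + length Y) (cong (8 +_) (+-comm 2 i)) (+-monoʳ-≤ 8 i<L))
  blocks : ∀ k → k < c → blockFactor (c ∸ suc k) a * d ≤ window Y (2 + k * 5)
  blocks k k<c = blockFactor-sound adm k (c ∸ suc k) a (begin-equality
      8 + length Y                                   ≡⟨ cong (8 +_) len ⟩
      8 + (c * 5 + suc a)                            ≡⟨ cong (λ c → 8 + (c * 5 + suc a)) (m+[n∸m]≡n k<c) ⟨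
      8 + ((suc k + (c ∸ suc k)) * 5 + suc a)        ≡⟨ split k (c ∸ suc k) a ⟩
      (10 + k * 5) + (4 + ((c ∸ suc k) * 5 + a))     ∎)
    where
    split : ∀ k u a → 8 + ((1 + k + u) * 5 + (1 + a)) ≡ (10 + k * 5) + (4 + (u * 5 + a))
    split = solve-∀

-- Closed form of the comoment bound

blockFactor-suc-suc : ∀ c a → blockFactor (suc c) (suc a) ≡ 2
blockFactor-suc-suc zero    a = refl
blockFactor-suc-suc (suc c) a = refl

blockWeight-0≡ : ∀ c → blockWeight (2 + c) 0 + 3 * (2 + c) + 7 ≡ 5 * ((2 + c) * (2 + c))
blockWeight-0≡ zero    = refl
blockWeight-0≡ (suc c) = begin
    (M * 2 + blockWeight (2 + c) 0) + 3 * (3 + c) + 7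
  ≡⟨ regroup M (blockWeight (2 + c) 0) c ⟩
    (blockWeight (2 + c) 0 + 3 * (2 + c) + 7) + (M * 2 + 3)
  ≡⟨ cong (_+ (M * 2 + 3)) (blockWeight-0≡ c) ⟩
    5 * ((2 + c) * (2 + c)) + (((2 + c) * 5 + 1) * 2 + 3)
  ≡⟨ square c ⟩
    5 * ((3 + c) * (3 + c))
  ∎
  where
  open ≡-Reasoning
  M : ℕ
  M = (2 + c) * 5 + 1
  regroup : ∀ M w c → (M * 2 + w) + 3 * (3 + c) + 7 ≡ (w + 3 * (2 + c) + 7) + (M * 2 + 3)
  regroup = solve-∀
  square : ∀ c → 5 * ((2 + c) * (2 + c)) + (((2 + c) * 5 + 1) * 2 + 3) ≡ 5 * ((3 + c) * (3 + c))
  square = solve-∀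

blockWeight-suc≡ : ∀ a c → blockWeight (suc c) (suc a) + 3 * suc c + suc a + 1
                        ≡ 5 * (suc c * suc c) + 2 * suc a * suc c
blockWeight-suc≡ a zero    = base a
  where
  base : ∀ a → (2 + a) * 1 + 0 + 3 * 1 + (1 + a) + 1 ≡ 5 * (1 * 1) + 2 * (1 + a) * 1
  base = solve-∀
blockWeight-suc≡ a (suc c) = begin
    (M * blockFactor (suc c) (suc a) + w) + 3 * (2 + c) + (1 + a) + 1
  ≡⟨ cong (λ f → (M * f + w) + 3 * (2 + c) + (1 + a) + 1) (blockFactor-suc-suc c a) ⟩
    (M * 2 + w) + 3 * (2 + c) + (1 + a) + 1
  ≡⟨ regroup M w c a ⟩
    (w + 3 * (1 + c) + (1 + a) + 1) + (M * 2 + 3)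
  ≡⟨ cong (_+ (M * 2 + 3)) (blockWeight-suc≡ a c) ⟩
    5 * ((1 + c) * (1 + c)) + 2 * (1 + a) * (1 + c) + (((1 + c) * 5 + (2 + a)) * 2 + 3)
  ≡⟨ square c a ⟩
    5 * ((2 + c) * (2 + c)) + 2 * (1 + a) * (2 + c)
  ∎
  where
  open ≡-Reasoning
  M w : ℕ
  M = suc c * 5 + suc (suc a)
  w = blockWeight (suc c) (suc a)
  regroup : ∀ M w c a → (M * 2 + w) + 3 * (2 + c) + (1 + a) + 1 ≡ (w + 3 * (1 + c) + (1 + a) + 1) + (M * 2 + 3)
  regroup = solve-∀
  square : ∀ c a → 5 * ((1 + c) * (1 + c)) + 2 * (1 + a) * (1 + c) + (((1 + c) * 5 + (2 + a)) * 2 + 3)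
                 ≡ 5 * ((2 + c) * (2 + c)) + 2 * (1 + a) * (2 + c)
  square = solve-∀

≤-comomentBound : ∀ d c a {M} → M ≤ blockWeight c a + (10 * c + 2 * a + 7)
           → d * M + 20 * c + 24 + a * suc a ≤ comomentBound d c a
≤-comomentBound d c a {M} M≤ = begin
    d * M + 20 * c + 24 + a * suc a
  ≤⟨ +-monoˡ-≤ (a * suc a) (+-monoˡ-≤ 24 (+-monoˡ-≤ (20 * c) (*-monoʳ-≤ d M≤))) ⟩
    d * (blockWeight c a + (10 * c + 2 * a + 7)) + 20 * c + 24 + a * suc a
  ≡⟨ regroup d c a (blockWeight c a) (a * suc a) ⟩
    comomentBound d c a
  ∎
  where
  open ≤-Reasoning
  regroup : ∀ d c a w t → d * (w + (10 * c + 2 * a + 7)) + 20 * c + 24 + t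
          ≡ (2 * (c * 5 + (1 + a)) + 5) * d + 24 + (d * w + 20 * c + t)
  regroup = solve-∀

cost≤comomentBound : ∀ d c → cost d c ≤ comomentBound d c 0
cost≤comomentBound d c = subst (_≤ comomentBound d c 0) (+-identityʳ (cost d c)) (≤-comomentBound d c 0 (weight c))
  where
  weight : ∀ c → 5 * (c * c) + 7 * c ≤ blockWeight c 0 + (10 * c + 2 * 0 + 7)
  weight 0             = z≤n
  weight 1             = ≤ᵇ⇒≤ 12 18 _
  weight (suc (suc c)) = ≤-reflexive (trans (cong (_+ 7 * (2 + c)) (sym (blockWeight-0≡ c))) (regroup _ c))
    where
    regroup : ∀ w c → w + 3 * (2 + c) + 7 + 7 * (2 + c) ≡ w + (10 * (2 + c) + 2 * 0 + 7)
    regroup = solve-∀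

closedBound : ℕ → ℕ → ℕ → ℕ
closedBound d c A = d * (5 * (c * c) + (2 * A + 7) * c + A + 6) + 20 * c + 24 + A * suc A

closedBound≤comomentBound : ∀ d c A → 1 ≤ A → closedBound d c A ≤ comomentBound d c A
closedBound≤comomentBound d c (suc a) _ =
  ≤-comomentBound d c A (subst₂ _≤_ (regroup₁ c A) (regroup₂ (blockWeight c A) c A)
                                    (+-monoˡ-≤ (7 * c + A + 6) (weight c)))
  where
  A : ℕ
  A = suc a
  weight : ∀ c → 5 * (c * c) + 2 * A * c ≤ blockWeight c A + 3 * c + A + 1
  weight zero    = subst (_≤ A + 1) (sym (*-zeroʳ (2 * A))) z≤n
  weight (suc c) = ≤-reflexive (sym (blockWeight-suc≡ a c))
  regroup₁ : ∀ c A → 5 * (c * c) + 2 * A * c + (7 * c + A + 6) ≡ 5 * (c * c) + (2 * A + 7) * c + A + 6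
  regroup₁ = solve-∀
  regroup₂ : ∀ w c A → w + 3 * c + A + 1 + (7 * c + A + 6) ≡ w + (10 * c + 2 * A + 7)
  regroup₂ = solve-∀

15A≤16+5A² : ∀ A → A ≤ 4 → 15 * A ≤ 2 * 8 + 5 * (A * A)
15A≤16+5A² 0 _ = z≤n
15A≤16+5A² 1 _ = ≤ᵇ⇒≤ 15 21 _
15A≤16+5A² 2 _ = ≤ᵇ⇒≤ 30 36 _
15A≤16+5A² 3 _ = ≤ᵇ⇒≤ 45 61 _
15A≤16+5A² 4 _ = ≤ᵇ⇒≤ 60 96 _
15A≤16+5A² (suc (suc (suc (suc (suc _))))) (s≤s (s≤s (s≤s (s≤s ()))))

cost-interpolation-closedBound : ∀ {d} c A → 8 ≤ d → A ≤ 4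
                               → 5 * cost d c + A * marginal-cost d c 1 ≤ 5 * closedBound d c A
cost-interpolation-closedBound {d} c A 8≤d A≤4 = +-cancelʳ-≤ (7 * A * d + 15 * A) _ _ (begin
    5 * cost d c + A * marginal-cost d c 1 + (7 * A * d + 15 * A)
  ≤⟨ +-monoʳ-≤ (5 * cost d c + A * marginal-cost d c 1) slack ⟩
    5 * cost d c + A * marginal-cost d c 1 + (30 * d + 5 * (A * A))
  ≡⟨ excess d c A ⟨
    5 * closedBound d c A + (7 * A * d + 15 * A)
  ∎)
  where
  open ≤-Reasoning
  -- 5 · closedBound − (5 · cost + A · marginal-cost) = d (30 − 7A) + 5A² − 15A, moved to both sides.
  excess : ∀ d c A → 5 * (d * (5 * (c * c) + (2 * A + 7) * c + A + 6) + 20 * c + 24 + A * (1 + A))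
                     + (7 * A * d + 15 * A)
                   ≡ 5 * (d * (5 * (c * c) + 7 * c) + 20 * c + 24) + A * (d * (10 * c + 5 * 1 + 7) + 20)
                     + (30 * d + 5 * (A * A))
  excess = solve-∀
  slack : 7 * A * d + 15 * A ≤ 30 * d + 5 * (A * A)
  slack = begin
      7 * A * d + 15 * A                ≤⟨ +-mono-≤ (*-monoˡ-≤ d (*-monoʳ-≤ 7 A≤4)) (15A≤16+5A² A A≤4) ⟩
      28 * d + (2 * 8 + 5 * (A * A))    ≤⟨ +-monoʳ-≤ (28 * d) (+-monoˡ-≤ (5 * (A * A)) (*-monoʳ-≤ 2 8≤d)) ⟩
      28 * d + (2 * d + 5 * (A * A))    ≡⟨ +-assoc (28 * d) (2 * d) _ ⟨
      28 * d + 2 * d + 5 * (A * A)      ≡⟨ cong (_+ 5 * (A * A)) (*-distribʳ-+ d 28 2) ⟨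
      30 * d + 5 * (A * A)              ∎

cost-interpolation : ∀ {d} c A → 8 ≤ d → A ≤ 4
                   → 5 * cost d c + A * marginal-cost d c 1 ≤ 5 * comomentBound d c A
cost-interpolation {d} c zero    _   _   =
  subst (_≤ 5 * comomentBound d c 0) (sym (+-identityʳ (5 * cost d c))) (*-monoʳ-≤ 5 (cost≤comomentBound d c))
cost-interpolation {d} c (suc a) 8≤d A≤4 =
  ≤-trans (cost-interpolation-closedBound c (suc a) 8≤d A≤4) (*-monoʳ-≤ 5 (closedBound≤comomentBound d c (suc a) (s≤s z≤n)))

-- The extremal sequence W

module _ (n δ : ℕ) (8≤d : 8 ≤ δ* δ) where
  private
    d p m : ℕ
    d = δ* δ
    p = pW n δ
    m = mW n δ
    A B₁ B₂ R T : List ℕ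
    A  = 1 ∷ 2 ∷ (d ∸ 3) ∷ []
    B₁ = 2 ∷ 2 ∷ 2 ∷ 2 ∷ (d ∸ 8) ∷ []
    B₂ = 2 ∷ 2 ∷ 2 ∷ 2 ∷ (2 * d ∸ 8) ∷ []
    R  = rep p B₂
    T  = rep 2 B₁ ++ [ m ]

    sum-A : sum A ≡ d
    sum-A = trans (cong (3 +_) (+-identityʳ (d ∸ 3))) (m+[n∸m]≡n (≤-trans (≤ᵇ⇒≤ 3 8 _) 8≤d))

    sum-block : ∀ {e} x → 8 + x ≡ e → sum (2 ∷ 2 ∷ 2 ∷ 2 ∷ x ∷ []) ≡ e
    sum-block x 8+x≡e = trans (cong (8 +_) (+-identityʳ x)) 8+x≡e

    sum-B₁ : sum B₁ ≡ d
    sum-B₁ = sum-block _ (m+[n∸m]≡n 8≤d)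

    sum-B₂ : sum B₂ ≡ 2 * d
    sum-B₂ = sum-block _ (m+[n∸m]≡n (≤-trans 8≤d (m≤m+n d (d + 0))))

    sum-T : sum T ≡ d + (d + m)
    sum-T = trans (sum-++ B₁ (B₁ ++ [ m ]))
                  (cong₂ _+_ sum-B₁ (trans (sum-++ B₁ [ m ]) (cong₂ _+_ sum-B₁ (+-identityʳ m))))

    comoment-T : comoment T ≡ 40 + 7 * d
    comoment-T = begin
        comoment (B₁ ++ B₁ ++ [ m ])
      ≡⟨ comoment-++ B₁ (B₁ ++ [ m ]) ⟩
        20 + 6 * sum B₁ + comoment (B₁ ++ [ m ])
      ≡⟨ cong₂ (λ s c → 20 + 6 * s + c) sum-B₁ (comoment-++ B₁ [ m ]) ⟩
        20 + 6 * d + (20 + 1 * sum B₁ + 0)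
      ≡⟨ cong (λ s → 20 + 6 * d + (20 + 1 * s + 0)) sum-B₁ ⟩
        20 + 6 * d + (20 + 1 * d + 0)
      ≡⟨ collect d ⟩
        40 + 7 * d
      ∎
      where
      open ≡-Reasoning
      collect : ∀ d → 20 + 6 * d + (20 + 1 * d + 0) ≡ 40 + 7 * d
      collect = solve-∀

    comoment-R : 2 * comoment R + p * (5 * (2 * d)) ≡ p * (40 + p * (5 * (2 * d)))
    comoment-R = subst (λ s → 2 * comoment R + p * (5 * s) ≡ p * (40 + p * (5 * s))) sum-B₂ (comoment-rep p B₂)

    length-RT : length (R ++ T) ≡ p * 5 + 11
    length-RT = trans (length-++ R) (cong (_+ 11) (length-rep p B₂))

    -- W n δ unfolds definitionally to A ++ B₁ ++ R ++ T.
    comoment-W-split : comoment (W n δ) ≡ comoment R + (64 + (32 * p + 34) * d)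
    comoment-W-split = begin
        comoment (A ++ B₁ ++ R ++ T)
      ≡⟨ comoment-++ A (B₁ ++ R ++ T) ⟩
        4 + (5 + length (R ++ T)) * sum A + comoment (B₁ ++ R ++ T)
      ≡⟨ cong₃ (λ ℓ s c → 4 + (5 + ℓ) * s + c) length-RT sum-A (comoment-++ B₁ (R ++ T)) ⟩
        4 + (5 + (p * 5 + 11)) * d + (20 + length (R ++ T) * sum B₁ + comoment (R ++ T))
      ≡⟨ cong₃ (λ ℓ s c → 4 + (5 + (p * 5 + 11)) * d + (20 + ℓ * s + c)) length-RT sum-B₁ (comoment-++ R T) ⟩
        4 + (5 + (p * 5 + 11)) * d + (20 + (p * 5 + 11) * d + (comoment R + 11 * sum R + comoment T))
      ≡⟨ cong₂ (λ s c → 4 + (5 + (p * 5 + 11)) * d + (20 + (p * 5 + 11) * d + (comoment R + 11 * s + c)))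
               (trans (sum-rep p B₂) (cong (p *_) sum-B₂)) comoment-T ⟩
        4 + (5 + (p * 5 + 11)) * d + (20 + (p * 5 + 11) * d + (comoment R + 11 * (p * (2 * d)) + (40 + 7 * d)))
      ≡⟨ collect (comoment R) p d ⟩
        comoment R + (64 + (32 * p + 34) * d)
      ∎
      where
      open ≡-Reasoning
      cong₃ : ∀ (f : ℕ → ℕ → ℕ → ℕ) {x y z x′ y′ z′} → x ≡ x′ → y ≡ y′ → z ≡ z′ → f x y z ≡ f x′ y′ z′
      cong₃ f refl refl refl = refl
      collect : ∀ C p d → 4 + (5 + (p * 5 + 11)) * d + (20 + (p * 5 + 11) * d + (C + 11 * (p * (2 * d)) + (40 + 7 * d)))
                        ≡ C + (64 + (32 * p + 34) * d)
      collect = solve-∀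

  comoment-W : comoment (W n δ) ≡ cost (δ* δ) (pW n δ + 2)
  comoment-W = *-cancelˡ-≡ _ _ 2 (+-cancelʳ-≡ (p * (5 * (2 * d))) _ _ (begin
      2 * comoment (W n δ) + p * (5 * (2 * d))
    ≡⟨ cong (λ c → 2 * c + p * (5 * (2 * d))) comoment-W-split ⟩
      2 * (comoment R + K) + p * (5 * (2 * d))
    ≡⟨ separate (comoment R) K (p * (5 * (2 * d))) ⟩
      (2 * comoment R + p * (5 * (2 * d))) + 2 * K
    ≡⟨ cong (_+ 2 * K) comoment-R ⟩
      p * (40 + p * (5 * (2 * d))) + 2 * K
    ≡⟨ collect p d ⟩
      2 * cost d (p + 2) + p * (5 * (2 * d))
    ∎))
    where
    open ≡-Reasoning
    K : ℕ
    K = 64 + (32 * p + 34) * d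
    separate : ∀ C K t → 2 * (C + K) + t ≡ (2 * C + t) + 2 * K
    separate = solve-∀
    collect : ∀ p d → p * (40 + p * (5 * (2 * d))) + 2 * (64 + (32 * p + 34) * d)
                    ≡ 2 * (d * (5 * ((p + 2) * (p + 2)) + 7 * (p + 2)) + 20 * (p + 2) + 24) + p * (5 * (2 * d))
    collect = solve-∀

  sum-W : sum (W n δ) ≡ (2 * pW n δ + 4) * δ* δ + mW n δ
  sum-W = begin
      sum (A ++ B₁ ++ R ++ T)
    ≡⟨ sum-++ A (B₁ ++ R ++ T) ⟩
      sum A + sum (B₁ ++ R ++ T)
    ≡⟨ cong₂ _+_ sum-A (sum-++ B₁ (R ++ T)) ⟩
      d + (sum B₁ + sum (R ++ T))
    ≡⟨ cong₂ (λ s t → d + (s + t)) sum-B₁ (sum-++ R T) ⟩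
      d + (d + (sum R + sum T))
    ≡⟨ cong₂ (λ s t → d + (d + (s + t))) (trans (sum-rep p B₂) (cong (p *_) sum-B₂)) sum-T ⟩
      d + (d + (p * (2 * d) + (d + (d + m))))
    ≡⟨ collect p d m ⟩
      (2 * p + 4) * d + m
    ∎
    where
    open ≡-Reasoning
    collect : ∀ p d m → d + (d + (p * (2 * d) + (d + (d + m)))) ≡ (2 * p + 4) * d + m
    collect = solve-∀

  length-W : length (W n δ) ≡ suc (5 * (pW n δ + 2) + 8)
  length-W = trans (cong (8 +_) length-RT) (collect p)
    where
    collect : ∀ p → 8 + (p * 5 + 11) ≡ 1 + (5 * (p + 2) + 8)
    collect = solve-∀

-- Comparison with W

g+comomentBound≤revenue : ∀ {d n} c A x₀ x₁ x₂ x₃ x₄ x₅ x₆ x₇ Y → length Y ≡ c * 5 + suc A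
                → Admissible d (x₀ ∷ x₁ ∷ x₂ ∷ x₃ ∷ x₄ ∷ x₅ ∷ x₆ ∷ x₇ ∷ Y)
                → sum (x₀ ∷ x₁ ∷ x₂ ∷ x₃ ∷ x₄ ∷ x₅ ∷ x₆ ∷ x₇ ∷ Y) ≡ n
                → g (x₀ ∷ x₁ ∷ x₂ ∷ x₃ ∷ x₄ ∷ x₅ ∷ x₆ ∷ x₇ ∷ Y) + comomentBound d c A ≤ revenue n c + A * n
g+comomentBound≤revenue {d} {n} c A x₀ x₁ x₂ x₃ x₄ x₅ x₆ x₇ Y len adm ΣX = begin
    g X + comomentBound d c A
  ≤⟨ +-monoʳ-≤ (g X) (comomentBound≤comoment c A x₀ x₁ x₂ x₃ x₄ x₅ x₆ x₇ Y len adm) ⟩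
    g X + comoment X
  ≡⟨ g+comoment x₀ xs ⟩
    (7 + length Y) * sum X
  ≡⟨ cong₂ (λ ℓ s → (7 + ℓ) * s) len ΣX ⟩
    (7 + (c * 5 + suc A)) * n
  ≡⟨ collect c A n ⟩
    revenue n c + A * n
  ∎
  where
  open ≤-Reasoning
  xs X : List ℕ
  xs = x₁ ∷ x₂ ∷ x₃ ∷ x₄ ∷ x₅ ∷ x₆ ∷ x₇ ∷ Y
  X = x₀ ∷ xs
  collect : ∀ c A n → (7 + (c * 5 + (1 + A))) * n ≡ (5 * c + 8) * n + A * n
  collect = solve-∀

-- The optimality of P at c and at c + 1, added with weights 5 − A and A.
revenue-cost-interpolation : ∀ {n d P} → (∀ x → revenue n x + cost d P ≤ revenue n P + cost d x)
  → ∀ c A → A ≤ 5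
  → 5 * (revenue n c + A * n) + 5 * cost d P ≤ 5 * revenue n P + (5 * cost d c + A * marginal-cost d c 1)
revenue-cost-interpolation {n} {d} {P} optimal c A A≤5 = begin
    5 * (revenue n c + A * n) + 5 * cost d P
  ≡⟨ regroup₁ (revenue n c) A n (cost d P) ⟩
    5 * (revenue n c + cost d P) + A * (5 * n)
  ≡⟨ cong (λ k → k * (revenue n c + cost d P) + A * (5 * n)) α+A≡5 ⟨
    (α + A) * (revenue n c + cost d P) + A * (5 * n)
  ≡⟨ spread α A (revenue n c) (cost d P) n ⟩
    α * (revenue n c + cost d P) + A * (revenue n c + 1 * (5 * n) + cost d P)
  ≡⟨ cong (λ r → α * (revenue n c + cost d P) + A * (r + cost d P)) (revenue-+ n c 1) ⟨
    α * (revenue n c + cost d P) + A * (revenue n (c + 1) + cost d P)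
  ≤⟨ +-mono-≤ (*-monoʳ-≤ α (optimal c)) (*-monoʳ-≤ A (optimal (c + 1))) ⟩
    α * (revenue n P + cost d c) + A * (revenue n P + cost d (c + 1))
  ≡⟨ cong (λ k → α * (revenue n P + cost d c) + A * (revenue n P + k)) (cost-+ d c 1) ⟩
    α * (revenue n P + cost d c) + A * (revenue n P + (cost d c + 1 * marginal-cost d c 1))
  ≡⟨ gather α A (revenue n P) (cost d c) (marginal-cost d c 1) ⟩
    (α + A) * (revenue n P + cost d c) + A * marginal-cost d c 1
  ≡⟨ cong (λ k → k * (revenue n P + cost d c) + A * marginal-cost d c 1) α+A≡5 ⟩
    5 * (revenue n P + cost d c) + A * marginal-cost d c 1
  ≡⟨ regroup₂ (revenue n P) (cost d c) (A * marginal-cost d c 1) ⟩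
    5 * revenue n P + (5 * cost d c + A * marginal-cost d c 1)
  ∎
  where
  open ≤-Reasoning
  α : ℕ
  α = 5 ∸ A
  α+A≡5 : α + A ≡ 5
  α+A≡5 = m∸n+n≡m A≤5
  regroup₁ : ∀ r A n k → 5 * (r + A * n) + 5 * k ≡ 5 * (r + k) + A * (5 * n)
  regroup₁ = solve-∀
  spread : ∀ α A r k n → (α + A) * (r + k) + A * (5 * n) ≡ α * (r + k) + A * (r + 1 * (5 * n) + k)
  spread = solve-∀
  gather : ∀ α A R c m → α * (R + c) + A * (R + (c + 1 * m)) ≡ (α + A) * (R + c) + A * m
  gather = solve-∀
  regroup₂ : ∀ R c t → 5 * (R + c) + t ≡ 5 * R + (5 * c + t)
  regroup₂ = solve-∀

module _ (n δ : ℕ) (4≤δ : 4 ≤ δ) (n-large : 32 * δ* δ + 20 < 5 * n) where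
  private
    d P : ℕ
    d = δ* δ
    P = pW n δ + 2

    8≤d : 8 ≤ d
    8≤d = 8≤δ* 4≤δ

    excess : ℕ
    excess = 5 * n ∸ (32 * d + 20)

    excess+ : excess + (32 * d + 20) ≡ 5 * n
    excess+ = m∸n+n≡m (<⇒≤ n-large)

    P-below : 10 * d * P + 2 * d + 20 < 5 * n
    P-below = begin-strict
        10 * d * (q + 2) + 2 * d + 20      ≡⟨ regroup d q ⟩
        q * (10 * d) + (22 * d + 20)       <⟨ +-monoˡ-< (22 * d + 20) (≤-<-trans (ceilDivSuc-upper excess _) (+-monoʳ-< excess (n<1+n _))) ⟩
        excess + 10 * d + (22 * d + 20)    ≡⟨ collect excess d ⟩
        excess + (32 * d + 20)             ≡⟨ excess+ ⟩
        5 * n                              ∎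
      where
      open ≤-Reasoning
      q : ℕ
      q = pW n δ
      regroup : ∀ d q → 10 * d * (q + 2) + 2 * d + 20 ≡ q * (10 * d) + (22 * d + 20)
      regroup = solve-∀
      collect : ∀ e d → e + 10 * d + (22 * d + 20) ≡ e + (32 * d + 20)
      collect = solve-∀

    P-above : 5 * n ≤ 10 * d * P + 12 * d + 20
    P-above = begin
        5 * n                           ≡⟨ excess+ ⟨
        excess + (32 * d + 20)          ≤⟨ +-monoˡ-≤ (32 * d + 20) (ceilDivSuc-lower excess _) ⟩
        q * (10 * d) + (32 * d + 20)    ≡⟨ regroup d q ⟩
        10 * d * P + 12 * d + 20        ∎
      where
      open ≤-Reasoning
      q : ℕ
      q = pW n δ
      regroup : ∀ d q → q * (10 * d) + (32 * d + 20) ≡ 10 * d * (q + 2) + 12 * d + 20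
      regroup = solve-∀

    optimal : ∀ x → revenue n x + cost d P ≤ revenue n P + cost d x
    optimal = revenue-cost-optimal {n} {d} {P} P-below P-above

    sum-W≡n : sum (W n δ) ≡ n
    sum-W≡n = trans (sum-W n δ 8≤d) (m+[n∸m]≡n (*-cancelˡ-≤ {(2 * pW n δ + 4) * d} {n} 5 (begin
        5 * ((2 * pW n δ + 4) * d)  ≡⟨ regroup (pW n δ) d ⟩
        10 * d * P + 0              ≤⟨ +-monoʳ-≤ (10 * d * P) z≤n ⟩
        10 * d * P + (2 * d + 20)   ≡⟨ +-assoc (10 * d * P) _ _ ⟨
        10 * d * P + 2 * d + 20     ≤⟨ <⇒≤ P-below ⟩
        5 * n                       ∎)))
      where
      open ≤-Reasoning
      regroup : ∀ p d → 5 * ((2 * p + 4) * d) ≡ 10 * d * (p + 2) + 0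
      regroup = solve-∀

    g-W : g (W n δ) + cost d P ≡ revenue n P
    g-W = begin
        g (W n δ) + cost d P                ≡⟨ cong (g (W n δ) +_) (comoment-W n δ 8≤d) ⟨
        g (W n δ) + comoment (W n δ)        ≡⟨ g+comoment 1 (tail (W n δ)) ⟩
        length (tail (W n δ)) * sum (W n δ) ≡⟨ cong₂ _*_ (suc-injective (length-W n δ 8≤d)) sum-W≡n ⟩
        (5 * P + 8) * n                     ∎
      where
      open ≡-Reasoning
      tail : List ℕ → List ℕ
      tail []       = []
      tail (_ ∷ xs) = xs

    below-optimum : ∀ {x} c A → A ≤ 4 → x + comomentBound d c A ≤ revenue n c + A * n → x ≤ g (W n δ)
    below-optimum {x} c A A≤4 x+B≤ = *-cancelˡ-≤ {x} {g (W n δ)} 5 (+-cancelʳ-≤ (5 * (B + cost d P)) _ _ (begin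
        5 * x + 5 * (B + cost d P)
      ≡⟨ regroup₁ x B (cost d P) ⟩
        5 * (x + B) + 5 * cost d P
      ≤⟨ +-monoˡ-≤ (5 * cost d P) (*-monoʳ-≤ 5 x+B≤) ⟩
        5 * (revenue n c + A * n) + 5 * cost d P
      ≤⟨ revenue-cost-interpolation {n} {d} {P} optimal c A (m≤n⇒m≤1+n A≤4) ⟩
        5 * revenue n P + (5 * cost d c + A * marginal-cost d c 1)
      ≤⟨ +-monoʳ-≤ (5 * revenue n P) (cost-interpolation c A 8≤d A≤4) ⟩
        5 * revenue n P + 5 * B
      ≡⟨ cong (λ r → 5 * r + 5 * B) g-W ⟨
        5 * (g (W n δ) + cost d P) + 5 * B
      ≡⟨ regroup₂ (g (W n δ)) (cost d P) B ⟩
        5 * g (W n δ) + 5 * (B + cost d P)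
      ∎))
      where
      open ≤-Reasoning
      B : ℕ
      B = comomentBound d c A
      regroup₁ : ∀ x B k → 5 * x + 5 * (B + k) ≡ 5 * (x + B) + 5 * k
      regroup₁ = solve-∀
      regroup₂ : ∀ g k B → 5 * (g + k) + 5 * B ≡ 5 * g + 5 * (B + k)
      regroup₂ = solve-∀

    7n≤g-W : 7 * n ≤ g (W n δ)
    7n≤g-W = +-cancelʳ-≤ 24 (7 * n) (g (W n δ)) (begin
        7 * n + 24            ≤⟨ +-monoʳ-≤ (7 * n) 24≤n ⟩
        7 * n + n             ≡⟨ +-comm (7 * n) n ⟩
        revenue n 0           ≤⟨ +-cancelʳ-≤ (cost d P) _ _ shifted ⟩
        g (W n δ) + 24        ∎)
      where
      open ≤-Reasoning
      24≤n : 24 ≤ n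
      24≤n = *-cancelˡ-≤ {24} {n} 5
        (≤-trans (≤ᵇ⇒≤ 120 276 _) (≤-trans (+-monoˡ-≤ 20 (*-monoʳ-≤ 32 8≤d)) (<⇒≤ n-large)))
      shifted : revenue n 0 + cost d P ≤ g (W n δ) + 24 + cost d P
      shifted = begin
          revenue n 0 + cost d P        ≤⟨ optimal 0 ⟩
          revenue n P + cost d 0        ≡⟨ cong₂ _+_ (sym g-W) (cong (λ z → z + 0 + 24) (*-zeroʳ d)) ⟩
          g (W n δ) + cost d P + 24     ≡⟨ xy∙z≈xz∙y (g (W n δ)) (cost d P) 24 ⟩
          g (W n δ) + 24 + cost d P     ∎

    g-short : ∀ X → length X ≤ 8 → sum X ≡ n → g X ≤ g (W n δ)
    g-short []       _         _  = z≤n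
    g-short (x ∷ xs) (s≤s ℓ≤7) ΣX = begin
        g (x ∷ xs)                        ≤⟨ m≤m+n (g (x ∷ xs)) (comoment (x ∷ xs)) ⟩
        g (x ∷ xs) + comoment (x ∷ xs)    ≡⟨ g+comoment x xs ⟩
        length xs * sum (x ∷ xs)          ≡⟨ cong (length xs *_) ΣX ⟩
        length xs * n                     ≤⟨ *-monoˡ-≤ n ℓ≤7 ⟩
        7 * n                             ≤⟨ 7n≤g-W ⟩
        g (W n δ)                         ∎
      where open ≤-Reasoning

    g-long : ∀ X k → 9 + k ≡ length X → Admissible d X → sum X ≡ n → g X ≤ g (W n δ)
    g-long (x₀ ∷ x₁ ∷ x₂ ∷ x₃ ∷ x₄ ∷ x₅ ∷ x₆ ∷ x₇ ∷ y ∷ Y) _ _ adm ΣX =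
      below-optimum (t / 5) (t % 5) (≤-pred (m%n<n t 5))
        (g+comomentBound≤revenue (t / 5) (t % 5) x₀ x₁ x₂ x₃ x₄ x₅ x₆ x₇ (y ∷ Y) len adm ΣX)
      where
      t : ℕ
      t = length Y
      len : suc t ≡ t / 5 * 5 + suc (t % 5)
      len = trans (cong suc (trans (m≡m%n+[m/n]*n t 5) (+-comm (t % 5) _))) (sym (+-suc _ (t % 5)))

  g-≤-g-W : ∀ X → Admissible d X → sum X ≡ n → g X ≤ g (W n δ)
  g-≤-g-W X adm ΣX with length X ≤? 8
  ... | yes ℓ≤8 = g-short X ℓ≤8 ΣX
  ... | no  ℓ≰8 = let k , 9+k≡ℓ = m≤n⇒∃[o]m+o≡n (≰⇒> ℓ≰8) in g-long X k 9+k≡ℓ adm ΣX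

lemma6p3 : (n δ : ℕ) → 4 ≤ δ → 32 * δ* δ + 20 < 5 * n
    → (X : List ℕ)
    → at X 0 ≡ 1
    → sum X ≡ n
    → (∀ i → 1 ≤ i → i + 2 ≤ length X → 2 ≤ at X i)
    → (∀ i → i < length X → 5 ∣ i → δ* δ ≤ window X i)
    → (∀ i → 10 ≤ i → i + 10 ≤ length X → 5 ∣ i → 2 * δ* δ ≤ window X i)
    → g X ≤ g (W n δ)
lemma6p3 n δ 4≤δ n-large X head≡1 ΣX entry≥2 window≥d window≥2d =
  g-≤-g-W n δ 4≤δ n-large X
    (record { head≡1 = head≡1 ; entry≥2 = entry≥2 ; window≥d = window≥d ; window≥2d = window≥2d }) ΣX
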